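{- Let $M=\begin{pmatrix}\rho_1&0\\0&\rho_2\end{pmatrix}$ with real numbers $\rho_1>\rho_2>0$. Let $H=\{(x,y)\in\mathbb{R}^2: c_1x+c_2y+c_3>0\}$ be a halfplane, with $c_1,c_2,c_3\in\mathbb{R}$, $(c_1,c_2)\neq(0,0)$. Let $\vec p\in\mathbb{R}^2$ and $\vec p_n=\vec p M^n$ for $n\ge 0$. Then the orbit $\vec p_0,\vec p_1,\ldots$ switches from $H$ to $\mathbb{R}^2\setminus H$, or conversely, at most twice, i.e. there are at most two indices $n\ge0$ such that exactly one of $\vec p_n,\vec p_{n+1}$ lies in $H$. In particular, from some index on, either the orbit is in $H$ and remains there forever, or it is outside $H$ and never enters $H$.
   Context: Points are row vectors. -}

module Defs where

open import Data.Nat using (ℕ; zero; suc)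
open import Data.Fin using (Fin; zero; suc)
open import Data.Product using (Σ; ∃; _×_; _,_)
open import Data.Sum using (_⊎_)
open import Relation.Nullary using (¬_)
open import Relation.Binary.PropositionalEquality using (_≡_)
open import Relation.Binary.Structures using (IsStrictTotalOrder)
open import Algebra.Structures using (IsCommutativeRing)

-- The real numbers, given axiomatically as a complete ordered field
-- (these axioms characterise ℝ up to isomorphism).
record Reals : Set₁ where
  infixl 6 _+_
  infixl 7 _*_
  infix 4 _<_ _≤_
  field
    ℝ   : Set
    _+_ : ℝ → ℝ → ℝ
    _*_ : ℝ → ℝ → ℝ
    -_  : ℝ → ℝ
    0ℝ  : ℝ
    1ℝ  : ℝ
    _<_ : ℝ → ℝ → Set
    isCommutativeRing : IsCommutativeRing _≡_ _+_ _*_ -_ 0ℝ 1ℝ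
    0≢1 : ¬ (0ℝ ≡ 1ℝ)
    inverse : ∀ x → ¬ (x ≡ 0ℝ) → Σ ℝ (λ y → x * y ≡ 1ℝ)
    isStrictTotalOrder : IsStrictTotalOrder _≡_ _<_
    +-mono-< : ∀ {x y} z → x < y → x + z < y + z
    *-pos : ∀ {x y} → 0ℝ < x → 0ℝ < y → 0ℝ < x * y

  _≤_ : ℝ → ℝ → Set
  x ≤ y = x < y ⊎ x ≡ y

  IsUpperBound : (ℝ → Set) → ℝ → Set
  IsUpperBound P b = ∀ x → P x → x ≤ b

  field
    completeness : (P : ℝ → Set) → ∃ P → ∃ (IsUpperBound P) →
                   Σ ℝ (λ s → IsUpperBound P s × (∀ b → IsUpperBound P b → s ≤ b))

module _ (R : Reals) where
  open Reals R

  Point : Set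
  Point = Fin 2 → ℝ

  Mat : Set
  Mat = Fin 2 → Fin 2 → ℝ

  _·ᵥ_ : Point → Mat → Point
  (v ·ᵥ A) j = v zero * A zero j + v (suc zero) * A (suc zero) j

  _·ₘ_ : Mat → Mat → Mat
  (A ·ₘ B) i j = A i zero * B zero j + A i (suc zero) * B (suc zero) j

  identity : Mat
  identity zero zero = 1ℝ
  identity zero (suc zero) = 0ℝ
  identity (suc zero) zero = 0ℝ
  identity (suc zero) (suc zero) = 1ℝ

  _^ₘ_ : Mat → ℕ → Mat
  A ^ₘ zero = identity
  A ^ₘ suc n = (A ^ₘ n) ·ₘ A

  diag : ℝ → ℝ → Mat
  diag a b zero zero = a
  diag a b zero (suc zero) = 0ℝ
  diag a b (suc zero) zero = 0ℝ
  diag a b (suc zero) (suc zero) = b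

  InHalfplane : ℝ → ℝ → ℝ → Point → Set
  InHalfplane c₁ c₂ c₃ v = 0ℝ < c₁ * v zero + c₂ * v (suc zero) + c₃

  Switch : (Point → Set) → Point → Point → Set
  Switch S u w = (S u × ¬ S w) ⊎ (¬ S u × S w)

{-# OPTIONS --safe #-}
module Submission where

-- The level c₁x + c₂y + c₃ of pₙ = (p₁ρ₁ⁿ, p₂ρ₂ⁿ) is gₙ = Aρ₁ⁿ + Bρ₂ⁿ + c, whose increments
-- Eₙ = Tρ₁ⁿ + Sρ₂ⁿ satisfy Eₙ₊₁ = ρ₂Eₙ + T(ρ₁ − ρ₂)ρ₁ⁿ.  So if T ≥ 0 a positive increment
-- stays positive, and if T ≤ 0 a negative one stays negative: g never rises and later falls,
-- or never falls and later rises.  Three switches would force such a pattern around the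
-- middle one: between two switches in the same direction g has to step the other way
-- (a discrete intermediate value argument).

open import Defs
open import Data.Nat using (ℕ; zero; suc; _≤′_; ≤′-refl; ≤′-step)
  renaming (_<_ to _<ℕ_; _≤_ to _≤ℕ_)
open import Data.Nat.Properties using (≤⇒≤′; ≤′⇒≤; <⇒≤; n<1+n; m≤n⇒m≤1+n)
open import Data.Fin using () renaming (zero to fzero; suc to fsuc)
open import Data.Product using (_×_; _,_; ∃-syntax)
open import Data.Sum using (_⊎_; inj₁; inj₂; swap)
open import Data.Empty using (⊥)
open import Function using (flip)
open import Relation.Nullary using (¬_; contradiction)
open import Relation.Binary.Core using (Rel)
open import Relation.Binary.Definitions using (Irreflexive; Cotransitive; tri<; tri≈; tri>)
open import Relation.Binary.Structures using (IsStrictTotalOrder)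
open import Relation.Binary.PropositionalEquality
  using (_≡_; refl; sym; trans; cong; cong₂; subst; subst₂; module ≡-Reasoning)
open import Algebra.Bundles using (CommutativeRing)
import Algebra.Properties.Ring as RingProperties
import Algebra.Properties.AbelianGroup as AbelianGroupProperties
import Algebra.Properties.Semiring.Exp as SemiringExp
import Algebra.Solver.Ring.NaturalCoefficients.Default as SemiringSolver

module _ {a ℓ} {A : Set a} {_≺_ : Rel A ℓ}
         (≺-irrefl : Irreflexive _≡_ _≺_) (≺-cotrans : Cotransitive _≺_) (g : ℕ → A) where

  step-between : ∀ {i j} → i ≤ℕ j → g i ≺ g j → ∃[ k ] i ≤ℕ k × k <ℕ j × g k ≺ g (suc k)
  step-between i≤j = go (≤⇒≤′ i≤j)
    where
    go : ∀ {i j} → i ≤′ j → g i ≺ g j → ∃[ k ] i ≤ℕ k × k <ℕ j × g k ≺ g (suc k)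
    go ≤′-refl gi≺gi = contradiction gi≺gi (≺-irrefl refl)
    go {i} (≤′-step {j} i≤′j) gi≺gsj with ≺-cotrans gi≺gsj (g j)
    ... | inj₁ gi≺gj = let k , i≤k , k<j , step = go i≤′j gi≺gj in k , i≤k , m≤n⇒m≤1+n k<j , step
    ... | inj₂ step = j , ≤′⇒≤ i≤′j , n<1+n j , step

data Direction : Set where
  ↑ ↓ : Direction

reverse : Direction → Direction
reverse ↑ = ↓
reverse ↓ = ↑

module Crossings {a ℓ} {A : Set a} {_<_ : Rel A ℓ} (<-isSTO : IsStrictTotalOrder _≡_ _<_) where
  open IsStrictTotalOrder <-isSTO using (compare; irrefl) renaming (trans to <-trans)

  <-cotrans : Cotransitive _<_
  <-cotrans {x} x<y z with compare x z
  ... | tri< x<z _ _ = inj₁ x<z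
  ... | tri≈ _ refl _ = inj₂ x<y
  ... | tri> _ _ z<x = inj₂ (<-trans z<x x<y)

  <-≮-trans : ∀ {x y z} → x < z → ¬ x < y → y < z
  <-≮-trans x<z x≮y with <-cotrans x<z _
  ... | inj₁ x<y = contradiction x<y x≮y
  ... | inj₂ y<z = y<z

  Moves : Direction → Rel A ℓ
  Moves ↑ = _<_
  Moves ↓ = flip _<_

  moves-irrefl : ∀ d → Irreflexive _≡_ (Moves d)
  moves-irrefl ↑ = irrefl
  moves-irrefl ↓ refl = irrefl refl

  moves-cotrans : ∀ d → Cotransitive (Moves d)
  moves-cotrans ↑ = <-cotrans
  moves-cotrans ↓ y<x z = swap (<-cotrans y<x z)

  module _ (g : ℕ → A) where

    Step : Direction → ℕ → Set ℓ
    Step d n = Moves d (g n) (g (suc n))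

    Persists : Direction → Set ℓ
    Persists d = ∀ {i j} → i ≤ℕ j → Step d i → Step (reverse d) j → ⊥

    persists⇒no-zigzag : ∃[ d ] Persists d → ∀ e {i j k} → i ≤ℕ j → j ≤ℕ k →
                         Step (reverse e) i → Step e j → Step (reverse e) k → ⊥
    persists⇒no-zigzag (↑ , persists) ↑ _   j≤k _  sj sk = persists j≤k sj sk
    persists⇒no-zigzag (↓ , persists) ↓ _   j≤k _  sj sk = persists j≤k sj sk
    persists⇒no-zigzag (↑ , persists) ↓ i≤j _   si sj _  = persists i≤j si sj
    persists⇒no-zigzag (↓ , persists) ↑ i≤j _   si sj _  = persists i≤j si sj

    module _ (level : A) where

      Above : ℕ → Set ℓ
      Above n = level < g n

      Crosses : Direction → ℕ → Set ℓ
      Crosses ↑ n = ¬ Above n × Above (suc n)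
      Crosses ↓ n = Above n × ¬ Above (suc n)

      crosses : ∀ {n} → (Above n × ¬ Above (suc n)) ⊎ (¬ Above n × Above (suc n)) →
                ∃[ d ] Crosses d n
      crosses (inj₁ leaves) = ↓ , leaves
      crosses (inj₂ enters) = ↑ , enters

      crosses⇒step : ∀ d {n} → Crosses d n → Step d n
      crosses⇒step ↑ (below , above) = <-≮-trans above below
      crosses⇒step ↓ (above , below) = <-≮-trans above below

      reversal-between : ∀ d {i j} → Crosses d i → i <ℕ j → Crosses d j →
                         ∃[ k ] i <ℕ k × k <ℕ j × Step (reverse d) k
      reversal-between ↑ (_ , above) i<j (below , _) =
        step-between (moves-irrefl ↓) (moves-cotrans ↓) g i<j (<-≮-trans above below)
      reversal-between ↓ (_ , below) i<j (above , _) =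
        step-between (moves-irrefl ↑) (moves-cotrans ↑) g i<j (<-≮-trans above below)

      step-before : ∀ d e {i j} → Crosses d i → i <ℕ j → Crosses e j →
                    ∃[ k ] k ≤ℕ j × Step (reverse e) k
      step-before ↑ ↑ ci i<j cj =
        let k , _ , k<j , s = reversal-between ↑ ci i<j cj in k , <⇒≤ k<j , s
      step-before ↓ ↓ ci i<j cj =
        let k , _ , k<j , s = reversal-between ↓ ci i<j cj in k , <⇒≤ k<j , s
      step-before ↑ ↓ ci i<j _  = _ , <⇒≤ i<j , crosses⇒step ↑ ci
      step-before ↓ ↑ ci i<j _  = _ , <⇒≤ i<j , crosses⇒step ↓ ci

      step-after : ∀ d e {i j} → Crosses d i → i <ℕ j → Crosses e j →
                   ∃[ k ] i ≤ℕ k × Step (reverse d) k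
      step-after ↑ ↑ ci i<j cj =
        let k , i<k , _ , s = reversal-between ↑ ci i<j cj in k , <⇒≤ i<k , s
      step-after ↓ ↓ ci i<j cj =
        let k , i<k , _ , s = reversal-between ↓ ci i<j cj in k , <⇒≤ i<k , s
      step-after ↑ ↓ _  i<j cj = _ , <⇒≤ i<j , crosses⇒step ↓ cj
      step-after ↓ ↑ _  i<j cj = _ , <⇒≤ i<j , crosses⇒step ↑ cj

      no-three-crossings : ∃[ d ] Persists d → ∀ {n₁ n₂ n₃} → n₁ <ℕ n₂ → n₂ <ℕ n₃ →
                           ∃[ d₁ ] Crosses d₁ n₁ → ∃[ d₂ ] Crosses d₂ n₂ → ∃[ d₃ ] Crosses d₃ n₃ → ⊥
      no-three-crossings persists n₁<n₂ n₂<n₃ (d₁ , c₁) (d₂ , c₂) (d₃ , c₃) =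
        let k₁ , k₁≤n₂ , s₁ = step-before d₁ d₂ c₁ n₁<n₂ c₂
            k₂ , n₂≤k₂ , s₂ = step-after d₂ d₃ c₂ n₂<n₃ c₃
        in persists⇒no-zigzag persists d₂ k₁≤n₂ n₂≤k₂ s₁ (crosses⇒step d₂ c₂) s₂

module OrderedField (R : Reals) where
  open Reals R public
  open IsStrictTotalOrder isStrictTotalOrder public using (asym) renaming (trans to <-trans)
  open IsStrictTotalOrder isStrictTotalOrder using (compare)

  commutativeRing : CommutativeRing _ _
  commutativeRing = record { isCommutativeRing = isCommutativeRing }

  open CommutativeRing commutativeRing public
    using (ring; _-_; +-identityˡ; +-identityʳ; *-comm; *-assoc; zeroʳ)
  open CommutativeRing commutativeRing
    using (semiring; commutativeSemiring; +-abelianGroup;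
           +-assoc; +-comm; -‿inverseˡ; -‿inverseʳ; zeroˡ)
  open RingProperties ring using (-1*x≈-x; -‿involutive; -0#≈0#)
  open AbelianGroupProperties +-abelianGroup using () renaming (xyx⁻¹≈y to x+y-x≡y)
  open SemiringExp semiring public using (_^_)
  open SemiringSolver commutativeSemiring public using (solve; _:=_; _:+_; _:*_; con)

  y+[x-y]≡x : ∀ x y → y + (x - y) ≡ x
  y+[x-y]≡x x y = trans (sym (+-assoc y x (- y))) (x+y-x≡y y x)

  x<x+y⇒0<y : ∀ {x y} → x < x + y → 0ℝ < y
  x<x+y⇒0<y {x} {y} h = subst₂ _<_ (-‿inverseʳ x) (x+y-x≡y x y) (+-mono-< (- x) h)

  x+y<x⇒y<0 : ∀ {x y} → x + y < x → y < 0ℝ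
  x+y<x⇒y<0 {x} {y} h = subst₂ _<_ (x+y-x≡y x y) (-‿inverseʳ x) (+-mono-< (- x) h)

  x<y⇒0<y-x : ∀ {x y} → x < y → 0ℝ < y - x
  x<y⇒0<y-x {x} {y} h = subst (_< y - x) (-‿inverseʳ x) (+-mono-< (- x) h)

  x<0⇒0<-x : ∀ {x} → x < 0ℝ → 0ℝ < - x
  x<0⇒0<-x {x} h = subst₂ _<_ (-‿inverseʳ x) (+-identityˡ (- x)) (+-mono-< (- x) h)

  0<-x⇒x<0 : ∀ {x} → 0ℝ < - x → x < 0ℝ
  0<-x⇒x<0 {x} h = subst₂ _<_ (+-identityˡ x) (-‿inverseˡ x) (+-mono-< x h)

  x≤0⇒0≤-x : ∀ {x} → x ≤ 0ℝ → 0ℝ ≤ - x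
  x≤0⇒0≤-x (inj₁ x<0) = inj₁ (x<0⇒0<-x x<0)
  x≤0⇒0≤-x (inj₂ refl) = inj₂ (sym -0#≈0#)

  0<1 : 0ℝ < 1ℝ
  0<1 with compare 0ℝ 1ℝ
  ... | tri< 0<1 _ _ = 0<1
  ... | tri≈ _ 0≡1 _ = contradiction 0≡1 0≢1
  ... | tri> _ _ 1<0 = contradiction (subst (0ℝ <_) -1*-1≡1 (*-pos 0<-1 0<-1)) (asym 1<0)
    where
    0<-1 : 0ℝ < - 1ℝ
    0<-1 = x<0⇒0<-x 1<0
    -1*-1≡1 : - 1ℝ * - 1ℝ ≡ 1ℝ
    -1*-1≡1 = trans (-1*x≈-x (- 1ℝ)) (-‿involutive 1ℝ)

  0<x⇒0<x^n : ∀ {x} → 0ℝ < x → ∀ n → 0ℝ < x ^ n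
  0<x⇒0<x^n _   zero    = 0<1
  0<x⇒0<x^n 0<x (suc n) = *-pos 0<x (0<x⇒0<x^n 0<x n)

  *-nonneg : ∀ {x y} → 0ℝ ≤ x → 0ℝ ≤ y → 0ℝ ≤ x * y
  *-nonneg (inj₁ 0<x) (inj₁ 0<y) = inj₁ (*-pos 0<x 0<y)
  *-nonneg {y = y} (inj₂ refl) _ = inj₂ (sym (zeroˡ y))
  *-nonneg {x = x} _ (inj₂ refl) = inj₂ (sym (zeroʳ x))

  +-pos-nonneg : ∀ {x y} → 0ℝ < x → 0ℝ ≤ y → 0ℝ < x + y
  +-pos-nonneg {x} 0<x (inj₂ refl) = subst (0ℝ <_) (sym (+-identityʳ x)) 0<x
  +-pos-nonneg {x} {y} 0<x (inj₁ 0<y) =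
    <-trans 0<x (subst₂ _<_ (+-identityˡ x) (+-comm y x) (+-mono-< x 0<y))

  sign-total : ∀ x → 0ℝ ≤ x ⊎ x ≤ 0ℝ
  sign-total x with compare 0ℝ x
  ... | tri< 0<x _ _ = inj₁ (inj₁ 0<x)
  ... | tri≈ _ 0≡x _ = inj₁ (inj₂ 0≡x)
  ... | tri> _ _ x<0 = inj₂ (inj₁ x<0)

module TwoExponentials (R : Reals) where
  open OrderedField R
  open Crossings isStrictTotalOrder using (Step; Persists)

  module _ {ρ₁ ρ₂ : ℝ} (ρ₂<ρ₁ : ρ₂ < ρ₁) (0<ρ₂ : 0ℝ < ρ₂) where
    open RingProperties ring using (-‿+-comm; -‿distribˡ-*)
    open ≡-Reasoning

    expSum : ℝ → ℝ → ℕ → ℝ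
    expSum T S n = T * ρ₁ ^ n + S * ρ₂ ^ n

    expSum-suc : ∀ T S n → expSum T S (suc n) ≡ ρ₂ * expSum T S n + T * ((ρ₁ - ρ₂) * ρ₁ ^ n)
    -- ρ₁ is written as ρ₂ + (ρ₁ − ρ₂) so that a semiring solver (no negation) applies.
    expSum-suc T S n = begin
      T * (ρ₁ * ρ₁ ^ n) + S * (ρ₂ * ρ₂ ^ n)
        ≡⟨ cong (λ r → T * (r * ρ₁ ^ n) + S * (ρ₂ * ρ₂ ^ n)) (sym (y+[x-y]≡x ρ₁ ρ₂)) ⟩
      T * ((ρ₂ + (ρ₁ - ρ₂)) * ρ₁ ^ n) + S * (ρ₂ * ρ₂ ^ n)
        ≡⟨ solve 6 (λ T S r δ X Y → T :* ((r :+ δ) :* X) :+ S :* (r :* Y)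
                                := r :* (T :* X :+ S :* Y) :+ T :* (δ :* X))
                 refl T S ρ₂ (ρ₁ - ρ₂) (ρ₁ ^ n) (ρ₂ ^ n) ⟩
      ρ₂ * expSum T S n + T * ((ρ₁ - ρ₂) * ρ₁ ^ n) ∎

    expSum-pos-suc : ∀ {T S n} → 0ℝ ≤ T → 0ℝ < expSum T S n → 0ℝ < expSum T S (suc n)
    expSum-pos-suc {T} {S} {n} 0≤T 0<E = subst (0ℝ <_) (sym (expSum-suc T S n))
      (+-pos-nonneg (*-pos 0<ρ₂ 0<E) (*-nonneg 0≤T (inj₁ (*-pos 0<ρ₁-ρ₂ (0<x⇒0<x^n 0<ρ₁ n)))))
      where
      0<ρ₁ : 0ℝ < ρ₁
      0<ρ₁ = <-trans 0<ρ₂ ρ₂<ρ₁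
      0<ρ₁-ρ₂ : 0ℝ < ρ₁ - ρ₂
      0<ρ₁-ρ₂ = x<y⇒0<y-x ρ₂<ρ₁

    expSum-pos-mono : ∀ {T S i j} → 0ℝ ≤ T → i ≤ℕ j → 0ℝ < expSum T S i → 0ℝ < expSum T S j
    expSum-pos-mono {T} {S} 0≤T i≤j = go (≤⇒≤′ i≤j)
      where
      go : ∀ {i j} → i ≤′ j → 0ℝ < expSum T S i → 0ℝ < expSum T S j
      go ≤′-refl              0<E = 0<E
      go (≤′-step {j} i≤′j) 0<E = expSum-pos-suc {n = j} 0≤T (go i≤′j 0<E)

    -expSum : ∀ T S n → - expSum T S n ≡ expSum (- T) (- S) n
    -expSum T S n = trans (sym (-‿+-comm (T * ρ₁ ^ n) (S * ρ₂ ^ n)))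
                          (cong₂ _+_ (-‿distribˡ-* T (ρ₁ ^ n)) (-‿distribˡ-* S (ρ₂ ^ n)))

    expSum-neg-mono : ∀ {T S i j} → T ≤ 0ℝ → i ≤ℕ j → expSum T S i < 0ℝ → expSum T S j < 0ℝ
    expSum-neg-mono {T} {S} {i} {j} T≤0 i≤j E<0 = 0<-x⇒x<0 (subst (0ℝ <_) (sym (-expSum T S j))
      (expSum-pos-mono (x≤0⇒0≤-x T≤0) i≤j (subst (0ℝ <_) (-expSum T S i) (x<0⇒0<-x E<0))))

    module _ {A B c : ℝ} {g : ℕ → ℝ} (closed-form : ∀ n → g n ≡ A * ρ₁ ^ n + B * ρ₂ ^ n + c) where

      T S : ℝ
      T = A * (ρ₁ - 1ℝ)
      S = B * (ρ₂ - 1ℝ)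

      increment : ∀ n → g (suc n) ≡ g n + expSum T S n
      increment n = begin
        g (suc n)
          ≡⟨ closed-form (suc n) ⟩
        A * (ρ₁ * ρ₁ ^ n) + B * (ρ₂ * ρ₂ ^ n) + c
          ≡⟨ cong₂ (λ r s → A * (r * ρ₁ ^ n) + B * (s * ρ₂ ^ n) + c)
                   (sym (y+[x-y]≡x ρ₁ 1ℝ)) (sym (y+[x-y]≡x ρ₂ 1ℝ)) ⟩
        A * ((1ℝ + (ρ₁ - 1ℝ)) * ρ₁ ^ n) + B * ((1ℝ + (ρ₂ - 1ℝ)) * ρ₂ ^ n) + c
          ≡⟨ solve 7 (λ A B c α β X Y → A :* ((con 1 :+ α) :* X) :+ B :* ((con 1 :+ β) :* Y) :+ c
                                    := (A :* X :+ B :* Y :+ c) :+ (A :* α :* X :+ B :* β :* Y))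
                   refl A B c (ρ₁ - 1ℝ) (ρ₂ - 1ℝ) (ρ₁ ^ n) (ρ₂ ^ n) ⟩
        (A * ρ₁ ^ n + B * ρ₂ ^ n + c) + expSum T S n
          ≡⟨ cong (_+ expSum T S n) (sym (closed-form n)) ⟩
        g n + expSum T S n ∎

      ascent⇒increment-pos : ∀ {n} → Step g ↑ n → 0ℝ < expSum T S n
      ascent⇒increment-pos {n} ascent = x<x+y⇒0<y (subst (g n <_) (increment n) ascent)

      descent⇒increment-neg : ∀ {n} → Step g ↓ n → expSum T S n < 0ℝ
      descent⇒increment-neg {n} descent = x+y<x⇒y<0 (subst (_< g n) (increment n) descent)

      exponential-persists : ∃[ d ] Persists g d
      exponential-persists with sign-total T
      ... | inj₁ 0≤T = ↑ , λ i≤j ascent descent →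
        asym (expSum-pos-mono 0≤T i≤j (ascent⇒increment-pos ascent)) (descent⇒increment-neg descent)
      ... | inj₂ T≤0 = ↓ , λ i≤j descent ascent →
        asym (expSum-neg-mono T≤0 i≤j (descent⇒increment-neg descent)) (ascent⇒increment-pos ascent)

module Orbit (R : Reals) where
  open OrderedField R
  open ≡-Reasoning

  ·ᵥ-·ₘ : ∀ v A B j → _·ᵥ_ R v (_·ₘ_ R A B) j ≡ _·ᵥ_ R (_·ᵥ_ R v A) B j
  ·ᵥ-·ₘ v A B j =
    solve 8 (λ v₀ v₁ a₀₀ a₀₁ a₁₀ a₁₁ b₀ b₁ →
               v₀ :* (a₀₀ :* b₀ :+ a₀₁ :* b₁) :+ v₁ :* (a₁₀ :* b₀ :+ a₁₁ :* b₁)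
            := (v₀ :* a₀₀ :+ v₁ :* a₁₀) :* b₀ :+ (v₀ :* a₀₁ :+ v₁ :* a₁₁) :* b₁)
          refl (v fzero) (v (fsuc fzero)) (A fzero fzero) (A fzero (fsuc fzero))
               (A (fsuc fzero) fzero) (A (fsuc fzero) (fsuc fzero)) (B fzero j) (B (fsuc fzero) j)

  ·ᵥ-diag : ∀ v a b j → _·ᵥ_ R v (diag R a b) j ≡ v j * diag R a b j j
  ·ᵥ-diag v a b fzero        = trans (cong (v fzero * a +_) (zeroʳ _)) (+-identityʳ _)
  ·ᵥ-diag v a b (fsuc fzero) = trans (cong (_+ v (fsuc fzero) * b) (zeroʳ _)) (+-identityˡ _)

  ·ᵥ-diag-^ₘ : ∀ v a b n j → _·ᵥ_ R v (_^ₘ_ R (diag R a b) n) j ≡ v j * diag R a b j j ^ n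
  -- identity R coincides entrywise with diag R 1ℝ 1ℝ.
  ·ᵥ-diag-^ₘ v a b zero fzero        = ·ᵥ-diag v 1ℝ 1ℝ fzero
  ·ᵥ-diag-^ₘ v a b zero (fsuc fzero) = ·ᵥ-diag v 1ℝ 1ℝ (fsuc fzero)
  ·ᵥ-diag-^ₘ v a b (suc n) j = begin
    _·ᵥ_ R v (_·ₘ_ R (_^ₘ_ R M n) M) j   ≡⟨ ·ᵥ-·ₘ v (_^ₘ_ R M n) M j ⟩
    _·ᵥ_ R (_·ᵥ_ R v (_^ₘ_ R M n)) M j   ≡⟨ ·ᵥ-diag (_·ᵥ_ R v (_^ₘ_ R M n)) a b j ⟩
    _·ᵥ_ R v (_^ₘ_ R M n) j * λⱼ          ≡⟨ cong (_* λⱼ) (·ᵥ-diag-^ₘ v a b n j) ⟩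
    v j * λⱼ ^ n * λⱼ                     ≡⟨ *-assoc (v j) (λⱼ ^ n) λⱼ ⟩
    v j * (λⱼ ^ n * λⱼ)                   ≡⟨ cong (v j *_) (*-comm (λⱼ ^ n) λⱼ) ⟩
    v j * λⱼ ^ suc n                      ∎
    where
    M = diag R a b
    λⱼ = diag R a b j j

  affine : ℝ → ℝ → ℝ → Point R → ℝ
  affine c₁ c₂ c₃ v = c₁ * v fzero + c₂ * v (fsuc fzero) + c₃

  affine-orbit : ∀ c₁ c₂ c₃ p a b n →
    affine c₁ c₂ c₃ (_·ᵥ_ R p (_^ₘ_ R (diag R a b) n))
      ≡ c₁ * p fzero * a ^ n + c₂ * p (fsuc fzero) * b ^ n + c₃
  affine-orbit c₁ c₂ c₃ p a b n = cong₂ (λ x y → x + y + c₃)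
    (trans (cong (c₁ *_) (·ᵥ-diag-^ₘ p a b n fzero)) (sym (*-assoc c₁ _ _)))
    (trans (cong (c₂ *_) (·ᵥ-diag-^ₘ p a b n (fsuc fzero))) (sym (*-assoc c₂ _ _)))

lemma4 : (R : Reals) → let open Reals R in
    (ρ₁ ρ₂ c₁ c₂ c₃ : ℝ) → ρ₂ < ρ₁ → 0ℝ < ρ₂ → ¬ (c₁ ≡ 0ℝ × c₂ ≡ 0ℝ) →
    (p : Point R) →
    let M = diag R ρ₁ ρ₂
        pₙ = λ (n : ℕ) → _·ᵥ_ R p (_^ₘ_ R M n)
        H = InHalfplane R c₁ c₂ c₃
    in (n₁ n₂ n₃ : ℕ) → n₁ <ℕ n₂ → n₂ <ℕ n₃ →
       Switch R H (pₙ n₁) (pₙ (suc n₁)) →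
       Switch R H (pₙ n₂) (pₙ (suc n₂)) →
       Switch R H (pₙ n₃) (pₙ (suc n₃)) → ⊥
lemma4 R ρ₁ ρ₂ c₁ c₂ c₃ ρ₂<ρ₁ 0<ρ₂ _ p n₁ n₂ n₃ n₁<n₂ n₂<n₃ s₁ s₂ s₃ =
  no-three-crossings level 0ℝ
    (exponential-persists ρ₂<ρ₁ 0<ρ₂ (affine-orbit c₁ c₂ c₃ p ρ₁ ρ₂))
    n₁<n₂ n₂<n₃ (crosses level 0ℝ s₁) (crosses level 0ℝ s₂) (crosses level 0ℝ s₃)
  where
  open OrderedField R
  open Crossings isStrictTotalOrder
  open Orbit R
  open TwoExponentials R

  -- Switch R H (pₙ n) (pₙ (suc n)) unfolds to a crossing of the level 0ℝ by this sequence.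
  level : ℕ → ℝ
  level n = affine c₁ c₂ c₃ (_·ᵥ_ R p (_^ₘ_ R (diag R ρ₁ ρ₂) n))
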